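{- If $f:\{0,1\}^n\to\{0,1\}$ is unate and $N=|f^{ -1}(1)|$, then $\Delta(z,z')\le 2\log N$ for all $z,z'\in f^{ -1}(1)$.
   Context: $f$ is unate if for each $i\in[n]$, $f$ is either monotone non-decreasing or monotone non-increasing in the $i$-th variable. $\Delta(z,z')$ is the Hamming distance. Logarithms are base 2. -}

module Defs where

open import Data.Nat using (ℕ; zero; suc; _+_)
open import Data.Bool using (Bool; true; false; _≤_; _≟_; if_then_else_)
open import Data.Vec using (Vec; []; _∷_; _[_]≔_)
open import Data.Fin using (Fin)
open import Data.List using (List; []; _∷_; _++_; map; filter; length)
open import Data.Sum using (_⊎_)

-- points of the Boolean cube {0,1}^n (false = 0, true = 1)
Cube : ℕ → Set
Cube n = Vec Bool n

allCube : (n : ℕ) → List (Cube n)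
allCube zero = [] ∷ []
allCube (suc n) = map (false ∷_) (allCube n) ++ map (true ∷_) (allCube n)

preimageSize : {n : ℕ} → (Cube n → Bool) → ℕ
preimageSize {n} f = length (filter (λ x → f x ≟ true) (allCube n))

hamming : {n : ℕ} → Cube n → Cube n → ℕ
hamming [] [] = 0
hamming (a ∷ z) (b ∷ z') = (if a Data.Bool.xor b then 1 else 0) + hamming z z'

NonDecreasingIn : {n : ℕ} → (Cube n → Bool) → Fin n → Set
NonDecreasingIn f i = ∀ x → f (x [ i ]≔ false) ≤ f (x [ i ]≔ true)

NonIncreasingIn : {n : ℕ} → (Cube n → Bool) → Fin n → Set
NonIncreasingIn f i = ∀ x → f (x [ i ]≔ true) ≤ f (x [ i ]≔ false)

Unate : {n : ℕ} → (Cube n → Bool) → Set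
Unate {n} f = (i : Fin n) → NonDecreasingIn f i ⊎ NonIncreasingIn f i

-- A unate f is monotone towards some preferred point d of the cube. If f z = 1,
-- then f stays 1 when any of the coordinates where z disagrees with d are moved
-- (to d), so f⁻¹(1) contains a subcube of dimension #{i | zᵢ ≠ dᵢ} through z.
-- Every coordinate where z and z' differ disagrees with d in z or in z', so the
-- two subcubes through z and z' have dimensions summing to at least Δ(z,z');
-- hence 2^Δ(z,z') ≤ N · N.
module Submission where

open import Defs
open import Data.Bool as Bool using (Bool; true; false; not; _xor_; if_then_else_; _≟_; b≤b)
open import Data.Bool.Properties as Bool using ()
import Data.Fin as Fin
open import Data.Fin.Subset using (Subset; ∣_∣)
open import Data.List as List using (List; filter; length; map)
open import Data.List.Properties using (filter-++; length-++)
open import Data.Nat using (ℕ; suc; _≤_; _^_; _+_; _*_; z≤n; s≤s)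
open import Data.Nat.Properties
  using (≤-refl; ≤-trans; m≤m+n; m≤n+m; +-mono-≤; *-mono-≤; ^-monoʳ-≤; ^-distribˡ-+-*; +-identityʳ; *-identityʳ; +-commutativeSemigroup; module ≤-Reasoning)
open import Algebra.Properties.CommutativeSemigroup +-commutativeSemigroup using (interchange)
open import Data.Product using (Σ; _×_; _,_; proj₁; proj₂)
open import Data.Sum using (_⊎_; inj₁; inj₂)
open import Data.Unit using (⊤; tt)
open import Data.Vec using ([]; _∷_; _[_]≔_)
open import Data.Vec.Functional using (Vector; head; tail)
open import Function using (_∘_)
open import Relation.Nullary using (Dec)
open import Relation.Binary.PropositionalEquality using (_≡_; refl; sym; cong; cong₂; module ≡-Reasoning)

private
  variable
    n : ℕ

bit : Bool → ℕ
bit b = if b then 1 else 0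

∣∷∣ : (b : Bool) (p : Subset n) → ∣ b ∷ p ∣ ≡ bit b + ∣ p ∣
∣∷∣ true  p = refl
∣∷∣ false p = refl

xor-triangle : ∀ e a b → bit (a xor b) ≤ bit (e xor a) + bit (e xor b)
xor-triangle false false b     = ≤-refl
xor-triangle true  true  b     = ≤-refl
xor-triangle false true  false = s≤s z≤n
xor-triangle false true  true  = z≤n
xor-triangle true  false false = z≤n
xor-triangle true  false true  = s≤s z≤n

preimageSize-∷ : (f : Cube (suc n) → Bool) →
  preimageSize f ≡ preimageSize (f ∘ (false ∷_)) + preimageSize (f ∘ (true ∷_))
preimageSize-∷ {n} f = begin
  length (filter f? (map (false ∷_) cube List.++ map (true ∷_) cube))
    ≡⟨ cong length (filter-++ f? (map (false ∷_) cube) (map (true ∷_) cube)) ⟩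
  length (filter f? (map (false ∷_) cube) List.++ filter f? (map (true ∷_) cube))
    ≡⟨ length-++ (filter f? (map (false ∷_) cube)) ⟩
  length (filter f? (map (false ∷_) cube)) + length (filter f? (map (true ∷_) cube))
    ≡⟨ cong₂ _+_ (length-filter-map (false ∷_) cube) (length-filter-map (true ∷_) cube) ⟩
  preimageSize (f ∘ (false ∷_)) + preimageSize (f ∘ (true ∷_)) ∎
  where
  open ≡-Reasoning
  cube : List (Cube n)
  cube = allCube n
  f? : (x : Cube (suc n)) → Dec (f x ≡ true)
  f? x = f x ≟ true
  length-filter-map : ∀ {A : Set} (h : A → Cube (suc n)) (xs : List A) →
    length (filter f? (map h xs)) ≡ length (filter (λ x → f (h x) ≟ true) xs)
  length-filter-map h List.[] = refl
  length-filter-map h (x List.∷ xs) with f (h x)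
  ... | true  = cong suc (length-filter-map h xs)
  ... | false = length-filter-map h xs

-- The point of the subcube through z with free coordinates m whose free
-- coordinates are read off x.
subcubePoint : Cube n → Subset n → Cube n → Cube n
subcubePoint []      []      []      = []
subcubePoint (c ∷ z) (i ∷ m) (a ∷ x) = (if i then a else c) ∷ subcubePoint z m x

2^dim≤preimageSize : (f : Cube n → Bool) (z : Cube n) (m : Subset n) →
  (∀ x → f (subcubePoint z m x) ≡ true) → 2 ^ ∣ m ∣ ≤ preimageSize f
2^dim≤preimageSize f [] [] onSubcube with f [] | onSubcube []
... | true | refl = ≤-refl
2^dim≤preimageSize f (c ∷ z) (false ∷ m) onSubcube rewrite preimageSize-∷ f with c
... | false = ≤-trans (2^dim≤preimageSize (f ∘ (false ∷_)) z m (onSubcube ∘ (false ∷_))) (m≤m+n _ _)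
... | true  = ≤-trans (2^dim≤preimageSize (f ∘ (true ∷_)) z m (onSubcube ∘ (true ∷_))) (m≤n+m _ _)
2^dim≤preimageSize f (c ∷ z) (true ∷ m) onSubcube rewrite preimageSize-∷ f | +-identityʳ (2 ^ ∣ m ∣) =
  +-mono-≤ (2^dim≤preimageSize (f ∘ (false ∷_)) z m (onSubcube ∘ (false ∷_)))
           (2^dim≤preimageSize (f ∘ (true ∷_)) z m (onSubcube ∘ (true ∷_)))

MonotoneTowards : (Cube n → Bool) → Vector Bool n → Set
MonotoneTowards f d = ∀ i x → f (x [ i ]≔ not (d i)) Bool.≤ f (x [ i ]≔ d i)

unate⇒monotoneTowards : (f : Cube n → Bool) → Unate f → Σ (Vector Bool n) (MonotoneTowards f)
unate⇒monotoneTowards f unate = (λ i → direction (unate i)) , (λ i → monotone (unate i))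
  where
  direction : ∀ {i} → NonDecreasingIn f i ⊎ NonIncreasingIn f i → Bool
  direction (inj₁ _) = true
  direction (inj₂ _) = false
  monotone : ∀ {i} (u : NonDecreasingIn f i ⊎ NonIncreasingIn f i) x →
    f (x [ i ]≔ not (direction u)) Bool.≤ f (x [ i ]≔ direction u)
  monotone (inj₁ nondecreasing) = nondecreasing
  monotone (inj₂ nonincreasing) = nonincreasing

MovedTowards : Vector Bool n → Cube n → Cube n → Set
MovedTowards d []      []      = ⊤
MovedTowards d (a ∷ x) (b ∷ y) = (b ≡ a ⊎ b ≡ head d) × MovedTowards (tail d) x y

movedTowards⇒≤ : (f : Cube n → Bool) (d : Vector Bool n) → MonotoneTowards f d →
  (x y : Cube n) → MovedTowards d x y → f x Bool.≤ f y
movedTowards⇒≤ f d mono []      []      tt = Bool.≤-refl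
movedTowards⇒≤ f d mono (a ∷ x) (b ∷ y) (moved , rest) =
  Bool.≤-trans (movedTowards⇒≤ (f ∘ (a ∷_)) (tail d) (λ i x → mono (Fin.suc i) (a ∷ x)) x y rest)
               (moveHead (head d) (mono Fin.zero (a ∷ y)) moved)
  where
  moveHead : ∀ e {a b} → f (not e ∷ y) Bool.≤ f (e ∷ y) → b ≡ a ⊎ b ≡ e → f (a ∷ y) Bool.≤ f (b ∷ y)
  moveHead e             increase (inj₁ refl) = Bool.≤-refl
  moveHead false {false} increase (inj₂ refl) = Bool.≤-refl
  moveHead true  {true}  increase (inj₂ refl) = Bool.≤-refl
  moveHead false {true}  increase (inj₂ refl) = increase
  moveHead true  {false} increase (inj₂ refl) = increase

awayFrom : Vector Bool n → Cube n → Subset n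
awayFrom d []      = []
awayFrom d (a ∷ z) = (head d xor a) ∷ awayFrom (tail d) z

subcube-awayFrom-movedTowards : (d : Vector Bool n) (z x : Cube n) →
  MovedTowards d z (subcubePoint z (awayFrom d z) x)
subcube-awayFrom-movedTowards d []      []      = tt
subcube-awayFrom-movedTowards d (a ∷ z) (c ∷ x) =
  headMoved (head d) a c , subcube-awayFrom-movedTowards (tail d) z x
  where
  headMoved : ∀ e a c → (if e xor a then c else a) ≡ a ⊎ (if e xor a then c else a) ≡ e
  headMoved false false c     = inj₁ refl
  headMoved true  true  c     = inj₁ refl
  headMoved false true  true  = inj₁ refl
  headMoved false true  false = inj₂ refl
  headMoved true  false false = inj₁ refl
  headMoved true  false true  = inj₂ refl

2^∣awayFrom∣≤preimageSize : (f : Cube n → Bool) (d : Vector Bool n) → MonotoneTowards f d →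
  (z : Cube n) → f z ≡ true → 2 ^ ∣ awayFrom d z ∣ ≤ preimageSize f
2^∣awayFrom∣≤preimageSize f d mono z fz≡1 = 2^dim≤preimageSize f z (awayFrom d z) λ x →
  ≤-true (movedTowards⇒≤ f d mono z _ (subcube-awayFrom-movedTowards d z x)) fz≡1
  where
  ≤-true : ∀ {a b} → a Bool.≤ b → a ≡ true → b ≡ true
  ≤-true b≤b refl = refl

hamming≤∣awayFrom∣+∣awayFrom∣ : (d : Vector Bool n) (z z' : Cube n) →
  hamming z z' ≤ ∣ awayFrom d z ∣ + ∣ awayFrom d z' ∣
hamming≤∣awayFrom∣+∣awayFrom∣ d []      []       = z≤n
hamming≤∣awayFrom∣+∣awayFrom∣ d (a ∷ z) (b ∷ z') = begin
  bit (a xor b) + hamming z z'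
    ≤⟨ +-mono-≤ (xor-triangle e a b) (hamming≤∣awayFrom∣+∣awayFrom∣ (tail d) z z') ⟩
  (bit (e xor a) + bit (e xor b)) + (∣ p ∣ + ∣ q ∣)
    ≡⟨ interchange (bit (e xor a)) (bit (e xor b)) ∣ p ∣ ∣ q ∣ ⟩
  (bit (e xor a) + ∣ p ∣) + (bit (e xor b) + ∣ q ∣)
    ≡⟨ sym (cong₂ _+_ (∣∷∣ (e xor a) p) (∣∷∣ (e xor b) q)) ⟩
  ∣ awayFrom d (a ∷ z) ∣ + ∣ awayFrom d (b ∷ z') ∣ ∎
  where
  open ≤-Reasoning
  e : Bool
  e = head d
  p q : Subset _
  p = awayFrom (tail d) z
  q = awayFrom (tail d) z'

lemma3p8 : (n : ℕ) (f : Cube n → Bool) → Unate f →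
    (z z' : Cube n) → f z ≡ true → f z' ≡ true →
    2 ^ hamming z z' ≤ preimageSize f ^ 2
lemma3p8 n f unate z z' fz≡1 fz'≡1 = begin
  2 ^ hamming z z'
    ≤⟨ ^-monoʳ-≤ 2 (hamming≤∣awayFrom∣+∣awayFrom∣ d z z') ⟩
  2 ^ (∣ awayFrom d z ∣ + ∣ awayFrom d z' ∣)
    ≡⟨ ^-distribˡ-+-* 2 ∣ awayFrom d z ∣ ∣ awayFrom d z' ∣ ⟩
  2 ^ ∣ awayFrom d z ∣ * 2 ^ ∣ awayFrom d z' ∣
    ≤⟨ *-mono-≤ (2^∣awayFrom∣≤preimageSize f d mono z fz≡1)
                (2^∣awayFrom∣≤preimageSize f d mono z' fz'≡1) ⟩
  N * N
    ≡⟨ cong (N *_) (sym (*-identityʳ N)) ⟩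
  N ^ 2 ∎
  where
  open ≤-Reasoning
  N : ℕ
  N = preimageSize f
  d : Vector Bool n
  d = proj₁ (unate⇒monotoneTowards f unate)
  mono : MonotoneTowards f d
  mono = proj₂ (unate⇒monotoneTowards f unate)
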